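{- Let $a,b,c,d$ be positive integers with $a<b$ and $d>c>b$, and let $A=\lceil\frac{a}{b-a}\rceil+1$. Assume that $\mathrm{dist}\big((c,d),T_{a,A}\big)\ge 2A(a+2b)$. Then the partizan subtraction game with $S_L=\{a,b\}$ and $S_R=\{c,d\}$ is ultimately $\mathcal L$, i.e. there exists $n_0$ such that $o(n)=\mathcal L$ for all $n\ge n_0$.
   Context: A partizan subtraction game $(S_L,S_R)$, with $S_L,S_R$ finite sets of positive integers, is played on a heap of $n$ tokens. Two players, Left and Right, alternate moves; Left removes $s\in S_L$ tokens and Right removes $s\in S_R$ tokens (at most the current heap size). A player unable to move loses. The outcome $o(n)$ is $\mathcal L$ (Left wins whoever starts), $\mathcal R$ (Right wins whoever starts), $\mathcal N$ (first player wins) or $\mathcal P$ (second player wins). For a real number $\alpha\ge1$, $T_{0,\alpha}$ is the set of pairs $(x,y)$ of positive integers such that $\gcd(x,y)\ge \frac{\max(x,y)}{\alpha}$, and for an integer $m\ge1$, $T_{m,\alpha}=\{(x-m,y-m):(x,y)\in T_{0,\alpha}\}$. For points $p=(x,y),p'=(x',y')$, $\mathrm{dist}(p,p')=|x-x'|+|y-y'|$, and $\mathrm{dist}(p,\mathcal D)=\min_{p''\in\mathcal D}\mathrm{dist}(p,p'')$. -}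

module Defs where

open import Data.Nat using (ℕ; zero; suc; _+_; _*_; _∸_; _≤_; _<_; _⊔_; _/_; ∣_-_∣)
open import Data.Nat.GCD using (gcd)
open import Data.Integer as ℤ using (ℤ; +_)
open import Data.List using (List; _∷_; [])
open import Data.List.Membership.Propositional using (_∈_)
open import Data.Product using (_×_; Σ; ∃; _,_)
open import Relation.Binary.PropositionalEquality using (_≡_)

-- Winning positions defined inductively (the game is finite, so the
-- least fixed point is the true game-theoretic winning region).

module Game (SL SR : List ℕ) where

  mutual
    data LFirstWins : ℕ → Set where
      lwin : ∀ {n s} → s ∈ SL → s ≤ n → RFirstLoses (n ∸ s) → LFirstWins n

    data RFirstLoses : ℕ → Set where
      rlose : ∀ {n} → (∀ s → s ∈ SR → s ≤ n → LFirstWins (n ∸ s)) → RFirstLoses n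

  mutual
    data RFirstWins : ℕ → Set where
      rwin : ∀ {n s} → s ∈ SR → s ≤ n → LFirstLoses (n ∸ s) → RFirstWins n

    data LFirstLoses : ℕ → Set where
      llose : ∀ {n} → (∀ s → s ∈ SL → s ≤ n → RFirstWins (n ∸ s)) → LFirstLoses n

  -- o(n) = 𝓛 : Left wins whoever starts.
  IsL : ℕ → Set
  IsL n = LFirstWins n × RFirstLoses n

  UltimatelyL : Set
  UltimatelyL = ∃ λ n₀ → ∀ n → n₀ ≤ n → IsL n

-- (x , y) ∈ T_{0,α} : x, y positive and gcd(x,y) ≥ max(x,y)/α,
-- i.e. α * gcd x y ≥ max x y.
InT0 : ℕ → ℕ → ℕ → Set
InT0 α x y = (0 < x) × (0 < y) × (x ⊔ y ≤ α * gcd x y)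

InT : ℕ → ℕ → ℤ → ℤ → Set
InT m α u v = Σ ℕ λ x → Σ ℕ λ y →
  InT0 α x y × (u ≡ + x ℤ.- + m) × (v ≡ + y ℤ.- + m)

distℤ : ℤ → ℤ → ℤ → ℤ → ℕ
distℤ x y x' y' = ℤ.∣ x ℤ.- x' ∣ + ℤ.∣ y ℤ.- y' ∣

-- dist((x,y), T_{m,α}) ≥ K  (the minimum over T is ≥ K iff every point
-- of T is at distance ≥ K; T_{m,α} is nonempty).
DistT≥ : ℤ → ℤ → ℕ → ℕ → ℕ → Set
DistT≥ x y m α K = ∀ u v → InT m α u v → K ≤ distℤ x y u v

-- Ceiling division ⌈ m / k ⌉ for k ≥ 1 (junk value 0 for k = 0).
ceilDiv : ℕ → ℕ → ℕ
ceilDiv m zero    = 0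
ceilDiv m (suc k) = (m + k) / suc k

Aconst : ℕ → ℕ → ℕ
Aconst a b = ceilDiv a (b ∸ a) + 1

-- Put C = a + c, D = a + d and δ = b − a, and call n exceptional when
-- n = P·C + Q·D + r with r < a and (P + Q)·δ ≤ r; there are finitely many
-- exceptional positions.  From a non-exceptional n, Left (moving first) removes
-- a or b so that Right cannot move to an exceptional position; by induction every
-- non-exceptional position is a win for Left moving first, and past the
-- exceptional set every move of Right lands on one.  If neither of Left's moves
-- worked, n and n − δ would both be written P·C + Q·D + r with r < a and
-- (P + Q)·δ ≤ r + δ.  Such representations are unique: an identity
-- i·C + e₁ = j·D + e₂ with 1 ≤ i, j ≤ A and e₁, e₂ < b would make
-- (j⌊C/j⌋ − a, i⌊C/j⌋ − a) a point of T_{a,A} at distance < 2A(a + 2b) from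
-- (c, d).  So the representation of n is that of n − δ with r raised by δ, and
-- n is exceptional.

module Submission where

open import Defs
open import Data.Nat using (ℕ; _+_; _*_; _<_)
open import Data.Integer using (+_)
open import Data.List using (_∷_; [])

open import Data.Nat using (zero; suc; _≤_; z<s; _∸_; _≤?_; _≟_; z≤n; s≤s; s≤s⁻¹; _/_; _%_; ∣_-_∣; NonZero; >-nonZero; ≢-nonZero)
open import Data.Nat.Properties
open import Data.Nat.DivMod using (m≡m%n+[m/n]*n; m%n<n; m<n*o⇒m/o<n; m≥n⇒m/n>0)
open import Data.Nat.Divisibility using (divides; ∣⇒≤)
open import Data.Nat.GCD using (gcd; gcd-greatest; gcd[m,n]≢0)
open import Data.Nat.Induction using (<-rec)
open import Data.Nat.Tactic.RingSolver using (solve-∀)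
import Data.Integer as ℤ
import Data.Integer.Properties as ℤ
import Data.Integer.Tactic.RingSolver as ℤ
open import Data.List using (List)
open import Data.List.Membership.Propositional using (find; lose)
open import Data.List.Relation.Unary.Any using (Any; here; there; any?)
open import Data.List.Relation.Unary.All as All using (All)
open import Data.Product using (_×_; _,_; ∃)
open import Data.Sum using (inj₁; inj₂)
open import Data.Empty using (⊥-elim)
open import Relation.Nullary using (¬_; Dec; yes; no; ¬?)
open import Relation.Nullary.Decidable using (_×-dec_; map′; decidable-stable)
open import Relation.Unary using (Decidable)
open import Relation.Binary.PropositionalEquality

m≤ceilDiv[m,k]*k : ∀ m k → 0 < k → m ≤ ceilDiv m k * k
m≤ceilDiv[m,k]*k m (suc k) _ = +-cancelʳ-≤ k m _ (begin
  m + k                       ≡⟨ m≡m%n+[m/n]*n (m + k) (suc k) ⟩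
  (m + k) % suc k + q * suc k ≤⟨ +-monoˡ-≤ (q * suc k) (s≤s⁻¹ (m%n<n (m + k) (suc k))) ⟩
  k + q * suc k               ≡⟨ +-comm k _ ⟩
  q * suc k + k               ∎)
  where
  open ≤-Reasoning
  q : ℕ
  q = (m + k) / suc k

ceilDiv[m,k]≤m : ∀ m k → ceilDiv m k ≤ m
ceilDiv[m,k]≤m m zero    = z≤n
ceilDiv[m,k]≤m m (suc k) = s≤s⁻¹ (m<n*o⇒m/o<n (begin-strict
  m + k             ≡⟨ +-comm m k ⟩
  k + m             ≤⟨ +-monoʳ-≤ k (m≤m*n m (suc k)) ⟩
  k + m * suc k     <⟨ n<1+n _ ⟩
  suc m * suc k     ∎))
  where open ≤-Reasoning

m*n+o<n⇒m≡0 : ∀ m {n o} → m * n + o < n → m ≡ 0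
m*n+o<n⇒m≡0 zero    _  = refl
m*n+o<n⇒m≡0 (suc m) {n} {o} lt = ⊥-elim (<⇒≱ lt (≤-trans (m≤m+n n (m * n)) (m≤m+n _ o)))

j*u+e≡j*v+f⇒u∸v<k : ∀ j k {u v e f} → v ≤ u → j * u + e ≡ j * v + f → f < j * k → u ∸ v < k
j*u+e≡j*v+f⇒u∸v<k j k {u} {v} {e} {f} v≤u eq f< = *-cancelˡ-< j (u ∸ v) k (begin-strict
  j * (u ∸ v)   ≡⟨ *-distribˡ-∸ j u v ⟩
  j * u ∸ j * v ≤⟨ m≤n+o⇒m∸n≤o (j * u) (j * v) (≤-trans (m≤m+n (j * u) e) (≤-reflexive eq)) ⟩
  f             <⟨ f< ⟩
  j * k         ∎)
  where open ≤-Reasoning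

j*u+e≡j*v+f⇒∣u-v∣<k : ∀ j k {u v e f} → j * u + e ≡ j * v + f → e < j * k → f < j * k → ∣ u - v ∣ < k
j*u+e≡j*v+f⇒∣u-v∣<k j k {u} {v} eq e< f< with ≤-total v u
... | inj₁ v≤u = subst (_< k) (sym (m≤n⇒∣n-m∣≡n∸m v≤u)) (j*u+e≡j*v+f⇒u∸v<k j k v≤u eq f<)
... | inj₂ u≤v = subst (_< k) (sym (m≤n⇒∣m-n∣≡n∸m u≤v)) (j*u+e≡j*v+f⇒u∸v<k j k u≤v (sym eq) e<)

m+n≡[m+o]+[n∸o] : ∀ m {n o} → o ≤ n → m + n ≡ m + o + (n ∸ o)
m+n≡[m+o]+[n∸o] m {n} {o} o≤n = trans (cong (λ z → m + z) (sym (m+[n∸m]≡n o≤n))) (sym (+-assoc m o (n ∸ o)))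

∣m⊖n∣≡∣m-n∣ : ∀ m n → ℤ.∣ m ℤ.⊖ n ∣ ≡ ∣ m - n ∣
∣m⊖n∣≡∣m-n∣ m n with ≤-total m n
... | inj₁ m≤n = trans (ℤ.∣⊖∣-≤ m≤n) (sym (m≤n⇒∣m-n∣≡n∸m m≤n))
... | inj₂ n≤m = trans (ℤ.∣m⊖n∣≡∣n⊖m∣ m n) (trans (ℤ.∣⊖∣-≤ n≤m) (sym (m≤n⇒∣n-m∣≡n∸m n≤m)))

∣c-[x-a]∣≡∣a+c-x∣ : ∀ a c x → ℤ.∣ + c ℤ.- (+ x ℤ.- + a) ∣ ≡ ∣ a + c - x ∣
∣c-[x-a]∣≡∣a+c-x∣ a c x = begin
  ℤ.∣ + c ℤ.- (+ x ℤ.- + a) ∣ ≡⟨ cong ℤ.∣_∣ (reassoc (+ a) (+ c) (+ x)) ⟩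
  ℤ.∣ + a ℤ.+ + c ℤ.- + x ∣   ≡⟨ cong (λ z → ℤ.∣ z ℤ.- + x ∣) (sym (ℤ.pos-+ a c)) ⟩
  ℤ.∣ + (a + c) ℤ.- + x ∣     ≡⟨ cong ℤ.∣_∣ (ℤ.[+m]-[+n]≡m⊖n (a + c) x) ⟩
  ℤ.∣ (a + c) ℤ.⊖ x ∣         ≡⟨ ∣m⊖n∣≡∣m-n∣ (a + c) x ⟩
  ∣ a + c - x ∣               ∎
  where
  open ≡-Reasoning
  reassoc : ∀ (a c x : ℤ.ℤ) → c ℤ.- (x ℤ.- a) ≡ a ℤ.+ c ℤ.- x
  reassoc = ℤ.solve-∀

distℤ-shifted : ∀ a c d x y →
  distℤ (+ c) (+ d) (+ x ℤ.- + a) (+ y ℤ.- + a) ≡ ∣ a + c - x ∣ + ∣ a + d - y ∣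
distℤ-shifted a c d x y = cong₂ _+_ (∣c-[x-a]∣≡∣a+c-x∣ a c x) (∣c-[x-a]∣≡∣a+c-x∣ a d y)

InT0-multiples : ∀ {α i j q} → 0 < i → 0 < j → 0 < q → i ≤ α → j ≤ α → InT0 α (j * q) (i * q)
InT0-multiples {α} {i} {j} {q} 0<i 0<j 0<q i≤α j≤α =
  0<x , ≤-trans 0<q (m≤n*m q i {{>-nonZero 0<i}}) ,
  ≤-trans (⊔-lub (*-monoˡ-≤ q j≤α) (*-monoˡ-≤ q i≤α)) (*-monoʳ-≤ α q≤gcd)
  where
  0<x : 0 < j * q
  0<x = ≤-trans 0<q (m≤n*m q j {{>-nonZero 0<j}})
  q≤gcd : q ≤ gcd (j * q) (i * q)
  q≤gcd = ∣⇒≤ {{≢-nonZero (gcd[m,n]≢0 _ _ (inj₁ (n>0⇒n≢0 0<x)))}}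
               (gcd-greatest (divides j refl) (divides i refl))

∣m-n*[m/n]∣<n : ∀ m n .{{_ : NonZero n}} → ∣ m - n * (m / n) ∣ < n
∣m-n*[m/n]∣<n m n = subst (_< n) (sym ∣m-nq∣≡r) (m%n<n m n)
  where
  open ≡-Reasoning
  q r : ℕ
  q = m / n
  r = m % n
  ∣m-nq∣≡r : ∣ m - n * q ∣ ≡ r
  ∣m-nq∣≡r = begin
    ∣ m - n * q ∣           ≡⟨ ∣-∣-comm m (n * q) ⟩
    ∣ n * q - m ∣           ≡⟨ cong ∣ n * q -_∣ (m≡m%n+[m/n]*n m n) ⟩
    ∣ n * q - r + q * n ∣   ≡⟨ cong (λ z → ∣ n * q - z ∣) (trans (+-comm r _) (cong (_+ r) (*-comm q n))) ⟩
    ∣ n * q - n * q + r ∣   ≡⟨ ∣m-m+n∣≡n (n * q) r ⟩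
    r                       ∎

∣D-i*[C/j]∣<i+b : ∀ {b i j C D e₁ e₂} .{{_ : NonZero j}} →
  i * C + e₁ ≡ j * D + e₂ → e₁ < b → e₂ < b → ∣ D - i * (C / j) ∣ < i + b
∣D-i*[C/j]∣<i+b {b} {i} {j} {C} {D} {e₁} {e₂} eq e₁<b e₂<b =
  j*u+e≡j*v+f⇒∣u-v∣<k j (i + b) jD+e₂≡j[iq]+[ir+e₁] e₂<j[i+b] ir+e₁<j[i+b]
  where
  q r : ℕ
  q = C / j
  r = C % j
  jD+e₂≡j[iq]+[ir+e₁] : j * D + e₂ ≡ j * (i * q) + (i * r + e₁)
  jD+e₂≡j[iq]+[ir+e₁] = begin
    j * D + e₂           ≡⟨ sym eq ⟩
    i * C + e₁           ≡⟨ cong (λ z → i * z + e₁) (m≡m%n+[m/n]*n C j) ⟩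
    i * (r + q * j) + e₁ ≡⟨ regroup i j r q e₁ ⟩
    j * (i * q) + (i * r + e₁) ∎
    where
    open ≡-Reasoning
    regroup : ∀ i j r q e → i * (r + q * j) + e ≡ j * (i * q) + (i * r + e)
    regroup = solve-∀
  b≤jb : b ≤ j * b
  b≤jb = m≤n*m b j
  e₂<j[i+b] : e₂ < j * (i + b)
  e₂<j[i+b] = <-≤-trans e₂<b (≤-trans b≤jb (*-monoʳ-≤ j (m≤n+m b i)))
  ir+e₁<j[i+b] : i * r + e₁ < j * (i + b)
  ir+e₁<j[i+b] = subst (i * r + e₁ <_) (sym (*-distribˡ-+ j i b))
    (+-mono-≤-< (≤-trans (*-monoʳ-≤ i (<⇒≤ (m%n<n C j))) (≤-reflexive (*-comm i j)))
                (<-≤-trans e₁<b b≤jb))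

m+[m+n]≤2*m*[o+2*n] : ∀ m n o → 0 < m → 0 < n → m + (m + n) ≤ 2 * m * (o + 2 * n)
m+[m+n]≤2*m*[o+2*n] (suc m) (suc n) o _ _ =
  subst (suc m + (suc m + suc n) ≤_) (sym (expand m n o)) (m≤m+n _ _)
  where
  expand : ∀ m n o → 2 * suc m * (o + 2 * suc n) ≡
    suc m + (suc m + suc n) + (2 * m * o + 4 * m * n + 2 * m + 2 * o + 3 * n + 1)
  expand = solve-∀

module Strategy (SL SR : List ℕ) (E : ℕ → Set) where
  open Game SL SR

  RightReaches : ℕ → Set
  RightReaches m = Any (λ s → s ≤ m × E (m ∸ s)) SR

  SafeMove : ℕ → ℕ → Set
  SafeMove n s = s ≤ n × ¬ RightReaches (n ∸ s)

  module _ (E? : Decidable E) where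

    rightReaches? : Decidable RightReaches
    rightReaches? m = any? (λ s → s ≤? m ×-dec E? (m ∸ s)) SR

    safeMove? : ∀ n s → Dec (SafeMove n s)
    safeMove? n s = s ≤? n ×-dec ¬? (rightReaches? (n ∸ s))

  module _ (SR-positive : All (0 <_) SR) (safe : ∀ n → ¬ E n → Any (SafeMove n) SL) where

    lFirstWins-outside : ∀ n → ¬ E n → LFirstWins n
    lFirstWins-outside = <-rec _ λ n rec ¬En →
      let s , s∈SL , s≤n , ¬reach = find (safe n ¬En) in
      lwin s∈SL s≤n (rlose λ s′ s′∈SR s′≤ →
        rec (<-≤-trans (∸-monoʳ-< (All.lookup SR-positive s′∈SR) s′≤) (m∸n≤m n s))
            (λ e → ¬reach (lose s′∈SR (s′≤ , e))))

    ultimatelyL : ∀ B m → (∀ n → E n → n < B) → All (_≤ m) SR → UltimatelyL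
    ultimatelyL B m bounded SR≤m = B + m , λ n B+m≤n →
      lFirstWins-outside n (outside (≤-trans (m≤m+n B m) B+m≤n)) ,
      rlose λ s s∈SR _ → lFirstWins-outside (n ∸ s)
        (outside (m+n≤o⇒m≤o∸n B (≤-trans (+-monoʳ-≤ B (All.lookup SR≤m s∈SR)) B+m≤n)))
      where
      outside : ∀ {n} → B ≤ n → ¬ E n
      outside B≤n e = <⇒≱ (bounded _ e) B≤n

regroup-PQ : ∀ P Q i j r x y → (P + i) * x + (Q + j) * y + r ≡ (P * x + Q * y) + (i * x + j * y + r)
regroup-PQ = solve-∀

regroup-P : ∀ P Q i r x y → (P + i) * x + Q * y + r ≡ (P * x + Q * y) + (i * x + r)
regroup-P = solve-∀

regroup-Q : ∀ P Q j r x y → P * x + (Q + j) * y + r ≡ (P * x + Q * y) + (j * y + r)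
regroup-Q = solve-∀

module SubtractionGame (a b c d : ℕ) (a<b : a < b) (b<c : b < c) (c<d : c < d) where

  δ C D A K : ℕ
  δ = b ∸ a
  C = a + c
  D = a + d
  A = Aconst a b
  K = 2 * A * (a + 2 * b)

  instance
    δ-nonZero : NonZero δ
    δ-nonZero = >-nonZero (m<n⇒0<n∸m a<b)

  a+δ≡b : a + δ ≡ b
  a+δ≡b = m+[n∸m]≡n (<⇒≤ a<b)

  a+δ≤A*δ : a + δ ≤ A * δ
  a+δ≤A*δ = begin
    a + δ                    ≤⟨ +-monoˡ-≤ δ (m≤ceilDiv[m,k]*k a δ (m<n⇒0<n∸m a<b)) ⟩
    ceilDiv a δ * δ + δ      ≡⟨ cong (λ z → ceilDiv a δ * δ + z) (sym (*-identityˡ δ)) ⟩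
    ceilDiv a δ * δ + 1 * δ  ≡⟨ sym (*-distribʳ-+ δ (ceilDiv a δ) 1) ⟩
    A * δ                    ∎
    where open ≤-Reasoning

  b<C : b < C
  b<C = ≤-trans b<c (m≤n+m c a)

  C≤D : C ≤ D
  C≤D = +-monoʳ-≤ a (<⇒≤ c<d)

  A≤C : A ≤ C
  A≤C = +-mono-≤ (ceilDiv[m,k]≤m a δ) (≤-trans (s≤s z≤n) b<c)

  value : ℕ → ℕ → ℕ → ℕ
  value P Q r = P * C + Q * D + r

  record Rep (slack n : ℕ) : Set where
    constructor rep
    field
      P Q r   : ℕ
      r<a     : r < a
      n≡value : n ≡ value P Q r
      weight≤ : (P + Q) * δ ≤ r + slack

  Exceptional : ℕ → Set
  Exceptional = Rep 0

  weight<A : ∀ {n} (R : Rep δ n) → Rep.P R + Rep.Q R < A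
  weight<A R = *-cancelʳ-< δ (P + Q) A (≤-<-trans weight≤ (<-≤-trans (+-monoˡ-< δ r<a) a+δ≤A*δ))
    where open Rep R

  weight<a : ∀ {n} (R : Exceptional n) → Rep.P R + Rep.Q R < a
  weight<a R = ≤-<-trans (≤-trans (m≤m*n (P + Q) δ) (≤-trans weight≤ (≤-reflexive (+-identityʳ r)))) r<a
    where open Rep R

  Exceptional-bounded : ∀ n → Exceptional n → n < a * D + a
  Exceptional-bounded n R = begin-strict
    n                 ≡⟨ n≡value ⟩
    P * C + Q * D + r <⟨ +-mono-≤-< PC+QD≤aD r<a ⟩
    a * D + a         ∎
    where
    open Rep R
    open ≤-Reasoning
    PC+QD≤aD : P * C + Q * D ≤ a * D
    PC+QD≤aD = begin
      P * C + Q * D ≤⟨ +-monoˡ-≤ (Q * D) (*-monoʳ-≤ P C≤D) ⟩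
      P * D + Q * D ≡⟨ sym (*-distribʳ-+ D P Q) ⟩
      (P + Q) * D   ≤⟨ *-monoˡ-≤ D (<⇒≤ (weight<a R)) ⟩
      a * D         ∎

  Exceptional? : Decidable Exceptional
  Exceptional? n = map′ fromBounded toBounded
    (anyUpTo? (λ P → anyUpTo? (λ Q → anyUpTo? (λ r →
      n ≟ value P Q r ×-dec (P + Q) * δ ≤? r + 0) a) a) a)
    where
    Bounded : Set
    Bounded = ∃ λ P → P < a × ∃ λ Q → Q < a × ∃ λ r → r < a × n ≡ value P Q r × (P + Q) * δ ≤ r + 0
    fromBounded : Bounded → Exceptional n
    fromBounded (P , _ , Q , _ , r , r<a , n≡ , w) = rep P Q r r<a n≡ w
    toBounded : Exceptional n → Bounded
    toBounded R = P , ≤-<-trans (m≤m+n P Q) (weight<a R) , Q , ≤-<-trans (m≤n+m Q P) (weight<a R) ,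
                  r , r<a , n≡value , weight≤
      where open Rep R

  weight-suc : ∀ k r s → k * δ ≤ r + s → suc k * δ ≤ r + (s + δ)
  weight-suc k r s w = begin
    δ + k * δ   ≤⟨ +-monoʳ-≤ δ w ⟩
    δ + (r + s) ≡⟨ +-comm δ (r + s) ⟩
    r + s + δ   ≡⟨ +-assoc r s δ ⟩
    r + (s + δ) ∎
    where open ≤-Reasoning

  Rep-C+ : ∀ {s m} → Rep s m → Rep (s + δ) (C + m)
  Rep-C+ (rep P Q r r<a refl w) = rep (suc P) Q r r<a (shift C D P Q r) (weight-suc (P + Q) r _ w)
    where
    shift : ∀ x y P Q r → x + (P * x + Q * y + r) ≡ suc P * x + Q * y + r
    shift = solve-∀

  Rep-D+ : ∀ {s m} → Rep s m → Rep (s + δ) (D + m)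
  Rep-D+ {s} (rep P Q r r<a refl w) =
    rep P (suc Q) r r<a (shift C D P Q r)
        (subst (λ z → z * δ ≤ r + (s + δ)) (sym (+-suc P Q)) (weight-suc (P + Q) r s w))
    where
    shift : ∀ x y P Q r → y + (P * x + Q * y + r) ≡ P * x + suc Q * y + r
    shift = solve-∀

  open Strategy (a ∷ b ∷ []) (c ∷ d ∷ []) Exceptional

  c≤-reaching : ∀ {m} → RightReaches m → c ≤ m
  c≤-reaching (here (c≤m , _))         = c≤m
  c≤-reaching (there (here (d≤m , _))) = ≤-trans (<⇒≤ c<d) d≤m

  Rep-reaching : ∀ {m} → RightReaches m → Rep δ (a + m)
  Rep-reaching (here (c≤m , ex))         = subst (Rep δ) (sym (m+n≡[m+o]+[n∸o] a c≤m)) (Rep-C+ ex)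
  Rep-reaching (there (here (d≤m , ex))) = subst (Rep δ) (sym (m+n≡[m+o]+[n∸o] a d≤m)) (Rep-D+ ex)

  module _ (far : DistT≥ (+ c) (+ d) a A K) where

    no-mixed : ∀ {i j e₁ e₂} → 0 < i → i ≤ A → 0 < j → j ≤ A → e₁ < b → e₂ < b →
               i * C + e₁ ≢ j * D + e₂
    no-mixed {i} {j} {e₁} {e₂} 0<i i≤A 0<j j≤A e₁<b e₂<b eq =
      <⇒≱ near (far _ _ (j * q , i * q , InT0-multiples 0<i 0<j 0<q i≤A j≤A , refl , refl))
      where
      instance
        j-nonZero : NonZero j
        j-nonZero = >-nonZero 0<j
      q : ℕ
      q = C / j
      0<q : 0 < q
      0<q = m≥n⇒m/n>0 (≤-trans j≤A A≤C)
      near : distℤ (+ c) (+ d) (+ (j * q) ℤ.- + a) (+ (i * q) ℤ.- + a) < K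
      near = begin-strict
        distℤ (+ c) (+ d) (+ (j * q) ℤ.- + a) (+ (i * q) ℤ.- + a)
          ≡⟨ distℤ-shifted a c d (j * q) (i * q) ⟩
        ∣ C - j * q ∣ + ∣ D - i * q ∣
          <⟨ +-mono-≤-< (<⇒≤ (∣m-n*[m/n]∣<n C j)) (∣D-i*[C/j]∣<i+b {j = j} {D = D} eq e₁<b e₂<b) ⟩
        j + (i + b)
          ≤⟨ +-mono-≤ j≤A (+-monoˡ-≤ b i≤A) ⟩
        A + (A + b)
          ≤⟨ m+[m+n]≤2*m*[o+2*n] A b a (m≤n+m 1 _) (≤-trans (s≤s z≤n) a<b) ⟩
        K ∎
        where open ≤-Reasoning

    ≡small⇒0 : ∀ k {E r r′} → C ≤ E → k * E + r ≡ r′ → r′ < C → k ≡ 0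
    ≡small⇒0 k C≤E eq r′<C = m*n+o<n⇒m≡0 k (<-≤-trans (≤-<-trans (≤-reflexive eq) r′<C) C≤E)

    absorbed : ∀ i j {r r′} → i * C + j * D + r ≡ r′ → r′ < C → i ≡ 0 × j ≡ 0 × r ≡ r′
    absorbed i j {r} eq r′<C with ≡small⇒0 i ≤-refl (trans (sym (+-assoc (i * C) (j * D) r)) eq) r′<C
    ... | refl with ≡small⇒0 j C≤D eq r′<C
    ...   | refl = refl , refl , eq

    balanced : ∀ i j {r₁ r₂} → i ≤ A → j ≤ A → r₁ < b → r₂ < b →
               i * C + r₁ ≡ j * D + r₂ → i ≡ 0 × j ≡ 0 × r₁ ≡ r₂
    balanced zero j _ _ r₁<b _ eq with ≡small⇒0 j C≤D (sym eq) (<-trans r₁<b b<C)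
    ... | refl = refl , refl , eq
    balanced (suc i) zero _ _ _ r₂<b eq = ⊥-elim (1+n≢0 (≡small⇒0 (suc i) ≤-refl eq (<-trans r₂<b b<C)))
    balanced (suc i) (suc j) i≤A j≤A r₁<b r₂<b eq = ⊥-elim (no-mixed z<s i≤A z<s j≤A r₁<b r₂<b eq)

    unique-≤ : ∀ {P₁ Q₁ r₁ P₂ Q₂ r₂} → P₂ ≤ P₁ → P₁ + Q₁ < A → P₂ + Q₂ < A → r₁ < b → r₂ < b →
               value P₁ Q₁ r₁ ≡ value P₂ Q₂ r₂ → P₁ ≡ P₂ × Q₁ ≡ Q₂ × r₁ ≡ r₂
    unique-≤ {Q₁ = Q₁} {r₁ = r₁} {P₂ = P₂} {Q₂ = Q₂} {r₂ = r₂} P₂≤P₁ w₁ w₂ r₁<b r₂<b eq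
      with m≤n⇒∃[o]m+o≡n P₂≤P₁ | ≤-total Q₂ Q₁
    ... | i , refl | inj₁ Q₂≤Q₁ with m≤n⇒∃[o]m+o≡n Q₂≤Q₁
    ...   | j , refl with absorbed i j (+-cancelˡ-≡ (P₂ * C + Q₂ * D) _ _
                          (trans (sym (regroup-PQ P₂ Q₂ i j r₁ C D)) eq)) (<-trans r₂<b b<C)
    ...     | refl , refl , refl = +-identityʳ P₂ , +-identityʳ Q₂ , refl
    unique-≤ {Q₁ = Q₁} {r₁ = r₁} {P₂ = P₂} {Q₂ = Q₂} {r₂ = r₂} P₂≤P₁ w₁ w₂ r₁<b r₂<b eq
        | i , refl | inj₂ Q₁≤Q₂ with m≤n⇒∃[o]m+o≡n Q₁≤Q₂
    ...   | j , refl
          with balanced i j (≤-trans (m≤n+m i P₂) (≤-trans (m≤m+n _ Q₁) (<⇒≤ w₁)))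
                            (≤-trans (m≤n+m j Q₁) (≤-trans (m≤n+m _ P₂) (<⇒≤ w₂))) r₁<b r₂<b
                 (+-cancelˡ-≡ (P₂ * C + Q₁ * D) _ _
                   (trans (sym (regroup-P P₂ Q₁ i r₁ C D)) (trans eq (regroup-Q P₂ Q₁ j r₂ C D))))
    ...     | refl , refl , refl = +-identityʳ P₂ , sym (+-identityʳ Q₁) , refl

    unique : ∀ {P₁ Q₁ r₁ P₂ Q₂ r₂} → P₁ + Q₁ < A → P₂ + Q₂ < A → r₁ < b → r₂ < b →
             value P₁ Q₁ r₁ ≡ value P₂ Q₂ r₂ → P₁ ≡ P₂ × Q₁ ≡ Q₂ × r₁ ≡ r₂
    unique {P₁} {P₂ = P₂} w₁ w₂ r₁<b r₂<b eq with ≤-total P₂ P₁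
    ... | inj₁ P₂≤P₁ = unique-≤ P₂≤P₁ w₁ w₂ r₁<b r₂<b eq
    ... | inj₂ P₁≤P₂ with unique-≤ P₁≤P₂ w₂ w₁ r₂<b r₁<b (sym eq)
    ...   | refl , refl , refl = refl , refl , refl

    consecutive : ∀ {m n} → n ≡ m + δ → Rep δ n → Rep δ m → Exceptional n
    consecutive refl R₁@(rep P₁ Q₁ r₁ r₁<a eq₁ _) R₂@(rep P₂ Q₂ r₂ r₂<a refl w₂)
      with unique {P₁} {Q₁} {r₁} {P₂} {Q₂} {r₂ + δ} (weight<A R₁) (weight<A R₂) (<-trans r₁<a a<b)
                  (subst (r₂ + δ <_) a+δ≡b (+-monoˡ-< δ r₂<a))
                  (trans (sym eq₁) (+-assoc (P₂ * C + Q₂ * D) r₂ δ))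
    ... | refl , refl , refl = rep P₂ Q₂ (r₂ + δ) r₁<a eq₁ (≤-trans w₂ (≤-reflexive (sym (+-identityʳ _))))

    both-unsafe : ∀ n → ¬ SafeMove n a → ¬ SafeMove n b → Exceptional n
    both-unsafe n unsafe-a unsafe-b with a ≤? n
    ... | no a≰n = rep 0 0 n (≰⇒> a≰n) refl z≤n
    ... | yes a≤n = consecutive n≡m+δ (subst (Rep δ) (m+[n∸m]≡n a≤n) (Rep-reaching reach-a))
                                      (Rep-reaching reach-b)
      where
      reaching : ∀ {s} → s ≤ n → ¬ SafeMove n s → RightReaches (n ∸ s)
      reaching s≤n unsafe = decidable-stable (rightReaches? Exceptional? _) (λ ¬r → unsafe (s≤n , ¬r))
      reach-a : RightReaches (n ∸ a)
      reach-a = reaching a≤n unsafe-a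
      b≤n : b ≤ n
      b≤n = ≤-trans (<⇒≤ b<c) (≤-trans (c≤-reaching reach-a) (m∸n≤m n a))
      reach-b : RightReaches (n ∸ b)
      reach-b = reaching b≤n unsafe-b
      n≡m+δ : n ≡ a + (n ∸ b) + δ
      n≡m+δ = begin
        n                 ≡⟨ sym (m+[n∸m]≡n b≤n) ⟩
        b + (n ∸ b)       ≡⟨ cong (_+ (n ∸ b)) (sym a+δ≡b) ⟩
        a + δ + (n ∸ b)   ≡⟨ +-assoc a δ _ ⟩
        a + (δ + (n ∸ b)) ≡⟨ cong (λ z → a + z) (+-comm δ _) ⟩
        a + ((n ∸ b) + δ) ≡⟨ sym (+-assoc a _ δ) ⟩
        a + (n ∸ b) + δ   ∎
        where open ≡-Reasoning

    safe-move : ∀ n → ¬ Exceptional n → Any (SafeMove n) (a ∷ b ∷ [])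
    safe-move n ¬E with safeMove? Exceptional? n a | safeMove? Exceptional? n b
    ... | yes safe-a | _          = here safe-a
    ... | no _       | yes safe-b = there (here safe-b)
    ... | no unsafe-a | no unsafe-b = ⊥-elim (¬E (both-unsafe n unsafe-a unsafe-b))

mainTheorem17 : (a b c d : ℕ) → 0 < a → a < b → b < c → c < d →
    DistT≥ (+ c) (+ d) a (Aconst a b) (2 * Aconst a b * (a + 2 * b)) →
    Game.UltimatelyL (a ∷ b ∷ []) (c ∷ d ∷ [])
mainTheorem17 a b c d _ a<b b<c c<d far =
  ultimatelyL (0<c All.∷ 0<d All.∷ All.[]) (safe-move far)
              (a * D + a) d Exceptional-bounded (<⇒≤ c<d All.∷ ≤-refl All.∷ All.[])
  where
  open SubtractionGame a b c d a<b b<c c<d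
  open Strategy (a ∷ b ∷ []) (c ∷ d ∷ []) Exceptional
  0<c : 0 < c
  0<c = ≤-trans (s≤s z≤n) b<c
  0<d : 0 < d
  0<d = <-trans 0<c c<d
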